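{- Let $\Gamma\Rightarrow\Delta$ be a sequent. If its structural Skolemization $(\Gamma\Rightarrow\Delta)^S$ is derivable in $\mathbf{LJ}^{++}$ by a cut-free proof using only atomic axioms, then $\Gamma\Rightarrow\Delta$ is cut-free $\mathbf{LJ}^{++}$-derivable.
   Context: Sequents are $\Gamma\Rightarrow\Delta$ with finite multisets of first-order formulas. $\mathbf{LK}$ is the usual first-order sequent calculus (axioms $p\Rightarrow p$, $p$ atomic, and $\bot\Rightarrow$; weakening, contraction, standard propositional rules, quantifier rules $(\forall L),(\exists R)$ with terms, $(\forall R),(\exists L)$ with eigenvariable condition, cut); $\mathbf{LJ}$ is its single-conclusion version. Rules $(\forall R),(\exists L)$ are strong-quantifier inferences and their eigen-variable $a$ is the characteristic variable. In a proof $\pi$, $a<_\pi b$ if $\pi$ contains a strong-quantifier inference from $\Gamma\Rightarrow A(a,b,\vec c)$ to $\Gamma\Rightarrow\forall xA(x,b,\vec c)$ or from $A(a,b,\vec c),\Gamma\Rightarrow\Delta$ to $\exists xA(x,b,\vec c),\Gamma\Rightarrow\Delta$. A quantifier inference is suitable for $\pi$ if it is a weak-quantifier inference, or its characteristic variable does not occur in the end-sequent of $\pi$, $<_\pi$ is acyclic, and any two strong-quantifier inferences with the same characteristic variable have the same principal formula. $\mathbf{LJ}^{++}$ is $\mathbf{LJ}$ without the eigenvariable condition, restricted to proofs all of whose quantifier inferences are suitable. Strong quantifiers: positive $\forall$ or negative $\exists$ (positive = in the antecedent of an even number of implications); structural Skolemization $F^S$ of a closed formula replaces successively the first strong quantifier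 $(Qy)$ by deleting it and substituting $f(x_1,\dots,x_n)$ for $y$, where $x_1,\dots,x_n$ are the variables of the weak quantifiers dominating it and $f$ is fresh. For a sequent, with $F=\bigwedge\Gamma\to\bigvee\Delta$ and $F^S=\bigwedge\Pi\to\bigvee\Lambda$, $(\Gamma\Rightarrow\Delta)^S:=\Pi\Rightarrow\Lambda$. -}

module Defs where

open import Data.Nat using (ℕ; zero; suc; _≤_; _∸_; _⊔_; _≡ᵇ_; _<ᵇ_)
open import Data.Bool using (Bool; true; false; not; if_then_else_; _∧_)
open import Data.List using (List; []; _∷_; _++_; map; length; foldr; [_])
open import Data.Unit using (⊤)
open import Data.Empty using (⊥)
open import Data.Product using (Σ; _×_; _,_; proj₁)
open import Relation.Binary.PropositionalEquality using (_≡_)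
open import Relation.Nullary using (¬_)
open import Data.List.Membership.Propositional using (_∈_; _∉_)
open import Data.List.Relation.Binary.Permutation.Propositional using (_↭_)
open import Relation.Binary.Construct.Closure.Transitive using (TransClosure)

-- First-order syntax, locally nameless:
--   var i  : bound variable (de Bruijn index)
--   par a  : free variable (also used as eigenvariables)
--   fn f ts: function symbol f (named by a natural number) applied to ts

data Term : Set where
  var : ℕ → Term
  par : ℕ → Term
  fn  : ℕ → List Term → Term

infixr 6 _∧'_
infixr 5 _∨'_
infixr 4 _⇒'_

data Formula : Set where
  atom  : ℕ → List Term → Formula
  ⊥'    : Formula
  _∧'_  : Formula → Formula → Formula
  _∨'_  : Formula → Formula → Formula
  _⇒'_  : Formula → Formula → Formula
  all'  : Formula → Formula   -- ∀x A, x is bound index 0 in A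
  ex'   : Formula → Formula

-- opening: replace bound index k by the (locally closed) term u
mutual
  openT : ℕ → Term → Term → Term
  openT k u (var i)   = if i ≡ᵇ k then u else var i
  openT k u (par a)   = par a
  openT k u (fn f ts) = fn f (openTs k u ts)

  openTs : ℕ → Term → List Term → List Term
  openTs k u []       = []
  openTs k u (t ∷ ts) = openT k u t ∷ openTs k u ts

openF : ℕ → Term → Formula → Formula
openF k u (atom P ts) = atom P (openTs k u ts)
openF k u ⊥'          = ⊥'
openF k u (A ∧' B)    = openF k u A ∧' openF k u B
openF k u (A ∨' B)    = openF k u A ∨' openF k u B
openF k u (A ⇒' B)    = openF k u A ⇒' openF k u B
openF k u (all' A)    = all' (openF (suc k) u A)
openF k u (ex' A)     = ex' (openF (suc k) u A)

inst : Formula → Term → Formula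
inst A t = openF 0 t A

mutual
  fvT : Term → List ℕ
  fvT (var i)   = []
  fvT (par a)   = a ∷ []
  fvT (fn f ts) = fvTs ts

  fvTs : List Term → List ℕ
  fvTs []       = []
  fvTs (t ∷ ts) = fvT t ++ fvTs ts

fvF : Formula → List ℕ
fvF (atom P ts) = fvTs ts
fvF ⊥'          = []
fvF (A ∧' B)    = fvF A ++ fvF B
fvF (A ∨' B)    = fvF A ++ fvF B
fvF (A ⇒' B)    = fvF A ++ fvF B
fvF (all' A)    = fvF A
fvF (ex' A)     = fvF A

fvL : List Formula → List ℕ
fvL []       = []
fvL (A ∷ As) = fvF A ++ fvL As

mutual
  bvT : Term → List ℕ
  bvT (var i)   = i ∷ []
  bvT (par a)   = []
  bvT (fn f ts) = bvTs ts

  bvTs : List Term → List ℕ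
  bvTs []       = []
  bvTs (t ∷ ts) = bvT t ++ bvTs ts

LCTerm : Term → Set
LCTerm t = bvT t ≡ []

allBelow : ℕ → List ℕ → Bool
allBelow k []       = true
allBelow k (i ∷ is) = (i <ᵇ k) ∧ allBelow k is

lcF : ℕ → Formula → Bool
lcF k (atom P ts) = allBelow k (bvTs ts)
lcF k ⊥'          = true
lcF k (A ∧' B)    = lcF k A ∧ lcF k B
lcF k (A ∨' B)    = lcF k A ∧ lcF k B
lcF k (A ⇒' B)    = lcF k A ∧ lcF k B
lcF k (all' A)    = lcF (suc k) A
lcF k (ex' A)     = lcF (suc k) A

ClosedF : Formula → Set
ClosedF A = (lcF 0 A ≡ true) × (fvF A ≡ [])

data AllClosed : List Formula → Set where
  []  : AllClosed []
  _∷_ : ∀ {A As} → ClosedF A → AllClosed As → AllClosed (A ∷ As)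

ClosedSequent : List Formula → List Formula → Set
ClosedSequent Γ Δ = AllClosed Γ × AllClosed Δ

-- LK proofs WITHOUT eigenvariable condition.  Sequents Γ ⇒ Δ are pairs of
-- lists; the exchange rule makes them multisets.  Principal formulas are
-- written at the head of the lists.

infix 3 _⊢_

data _⊢_ : List Formula → List Formula → Set where
  ax    : ∀ P ts → (atom P ts ∷ []) ⊢ (atom P ts ∷ [])
  botL  : (⊥' ∷ []) ⊢ []
  exch  : ∀ {Γ Γ' Δ Δ'} → Γ ↭ Γ' → Δ ↭ Δ' → Γ ⊢ Δ → Γ' ⊢ Δ'
  wL    : ∀ {Γ Δ} A → Γ ⊢ Δ → (A ∷ Γ) ⊢ Δ
  wR    : ∀ {Γ Δ} A → Γ ⊢ Δ → Γ ⊢ (A ∷ Δ)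
  cL    : ∀ {Γ Δ A} → (A ∷ A ∷ Γ) ⊢ Δ → (A ∷ Γ) ⊢ Δ
  cR    : ∀ {Γ Δ A} → Γ ⊢ (A ∷ A ∷ Δ) → Γ ⊢ (A ∷ Δ)
  ∧L₁   : ∀ {Γ Δ A} B → (A ∷ Γ) ⊢ Δ → ((A ∧' B) ∷ Γ) ⊢ Δ
  ∧L₂   : ∀ {Γ Δ B} A → (B ∷ Γ) ⊢ Δ → ((A ∧' B) ∷ Γ) ⊢ Δ
  ∧R    : ∀ {Γ Δ A B} → Γ ⊢ (A ∷ Δ) → Γ ⊢ (B ∷ Δ) → Γ ⊢ ((A ∧' B) ∷ Δ)
  ∨L    : ∀ {Γ Δ A B} → (A ∷ Γ) ⊢ Δ → (B ∷ Γ) ⊢ Δ → ((A ∨' B) ∷ Γ) ⊢ Δ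
  ∨R₁   : ∀ {Γ Δ A} B → Γ ⊢ (A ∷ Δ) → Γ ⊢ ((A ∨' B) ∷ Δ)
  ∨R₂   : ∀ {Γ Δ B} A → Γ ⊢ (B ∷ Δ) → Γ ⊢ ((A ∨' B) ∷ Δ)
  ⇒L    : ∀ {Γ Δ Π Λ A B} → Γ ⊢ (A ∷ Δ) → (B ∷ Π) ⊢ Λ →
          ((A ⇒' B) ∷ (Γ ++ Π)) ⊢ (Δ ++ Λ)
  ⇒R    : ∀ {Γ Δ A B} → (A ∷ Γ) ⊢ (B ∷ Δ) → Γ ⊢ ((A ⇒' B) ∷ Δ)
  ∀L    : ∀ {Γ Δ} A t → LCTerm t → (inst A t ∷ Γ) ⊢ Δ → (all' A ∷ Γ) ⊢ Δ
  ∃R    : ∀ {Γ Δ} A t → LCTerm t → Γ ⊢ (inst A t ∷ Δ) → Γ ⊢ (ex' A ∷ Δ)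
  -- strong quantifier inferences with characteristic variable a
  -- (no eigenvariable condition)
  ∀R    : ∀ {Γ Δ} A a → Γ ⊢ (inst A (par a) ∷ Δ) → Γ ⊢ (all' A ∷ Δ)
  ∃L    : ∀ {Γ Δ} A a → (inst A (par a) ∷ Γ) ⊢ Δ → (ex' A ∷ Γ) ⊢ Δ
  cut   : ∀ {Γ Δ Π Λ} A → Γ ⊢ (A ∷ Δ) → (A ∷ Π) ⊢ Λ → (Γ ++ Π) ⊢ (Δ ++ Λ)

CutFree : ∀ {Γ Δ} → Γ ⊢ Δ → Set
CutFree (ax P ts)     = ⊤
CutFree botL          = ⊤
CutFree (exch _ _ π)  = CutFree π
CutFree (wL A π)      = CutFree π
CutFree (wR A π)      = CutFree π
CutFree (cL π)        = CutFree π
CutFree (cR π)        = CutFree π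
CutFree (∧L₁ B π)     = CutFree π
CutFree (∧L₂ A π)     = CutFree π
CutFree (∧R π ρ)      = CutFree π × CutFree ρ
CutFree (∨L π ρ)      = CutFree π × CutFree ρ
CutFree (∨R₁ B π)     = CutFree π
CutFree (∨R₂ A π)     = CutFree π
CutFree (⇒L π ρ)      = CutFree π × CutFree ρ
CutFree (⇒R π)        = CutFree π
CutFree (∀L A t _ π)  = CutFree π
CutFree (∃R A t _ π)  = CutFree π
CutFree (∀R A a π)    = CutFree π
CutFree (∃L A a π)    = CutFree π
CutFree (cut A π ρ)   = ⊥

mutual
  LJ : ∀ {Γ Δ} → Γ ⊢ Δ → Set
  LJ {Γ} {Δ} π = (length Δ ≤ 1) × LJsub π

  LJsub : ∀ {Γ Δ} → Γ ⊢ Δ → Set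
  LJsub (ax P ts)     = ⊤
  LJsub botL          = ⊤
  LJsub (exch _ _ π)  = LJ π
  LJsub (wL A π)      = LJ π
  LJsub (wR A π)      = LJ π
  LJsub (cL π)        = LJ π
  LJsub (cR π)        = LJ π
  LJsub (∧L₁ B π)     = LJ π
  LJsub (∧L₂ A π)     = LJ π
  LJsub (∧R π ρ)      = LJ π × LJ ρ
  LJsub (∨L π ρ)      = LJ π × LJ ρ
  LJsub (∨R₁ B π)     = LJ π
  LJsub (∨R₂ A π)     = LJ π
  LJsub (⇒L π ρ)      = LJ π × LJ ρ
  LJsub (⇒R π)        = LJ π
  LJsub (∀L A t _ π)  = LJ π
  LJsub (∃R A t _ π)  = LJ π
  LJsub (∀R A a π)    = LJ π
  LJsub (∃L A a π)    = LJ π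
  LJsub (cut A π ρ)   = LJ π × LJ ρ

strongs : ∀ {Γ Δ} → Γ ⊢ Δ → List (ℕ × Formula)
strongs (ax P ts)     = []
strongs botL          = []
strongs (exch _ _ π)  = strongs π
strongs (wL A π)      = strongs π
strongs (wR A π)      = strongs π
strongs (cL π)        = strongs π
strongs (cR π)        = strongs π
strongs (∧L₁ B π)     = strongs π
strongs (∧L₂ A π)     = strongs π
strongs (∧R π ρ)      = strongs π ++ strongs ρ
strongs (∨L π ρ)      = strongs π ++ strongs ρ
strongs (∨R₁ B π)     = strongs π
strongs (∨R₂ A π)     = strongs π
strongs (⇒L π ρ)      = strongs π ++ strongs ρ
strongs (⇒R π)        = strongs π
strongs (∀L A t _ π)  = strongs π
strongs (∃R A t _ π)  = strongs π
strongs (∀R A a π)    = (a , all' A) ∷ strongs π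
strongs (∃L A a π)    = (a , ex' A) ∷ strongs π
strongs (cut A π ρ)   = strongs π ++ strongs ρ

_<[_]_ : ∀ {Γ Δ} → ℕ → Γ ⊢ Δ → ℕ → Set
a <[ π ] b = Σ Formula λ F → ((a , F) ∈ strongs π) × (b ∈ fvF F)

Acyclic : ∀ {Γ Δ} → Γ ⊢ Δ → Set
Acyclic π = ∀ a → ¬ TransClosure (λ x y → x <[ π ] y) a a

Suitable : ∀ {Γ Δ} → Γ ⊢ Δ → Set
Suitable {Γ} {Δ} π =
    (∀ {a F} → (a , F) ∈ strongs π → a ∉ (fvL Γ ++ fvL Δ))
  × Acyclic π
  × (∀ {a F G} → (a , F) ∈ strongs π → (a , G) ∈ strongs π → F ≡ G)

CutFreeLJ⁺⁺ : List Formula → List Formula → Set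
CutFreeLJ⁺⁺ Γ Δ = Σ (Γ ⊢ Δ) λ π → CutFree π × LJ π × Suitable π

-- The traversal keeps an environment mapping the bound variables of the
-- input formula to terms of the output formula, where `var l` inside an
-- environment entry denotes the output binder of de Bruijn LEVEL l.
-- ws = levels of the (output) weak quantifiers dominating the position,
-- e  = current output binder depth, c = next fresh function symbol.

mutual
  lvlT : ℕ → Term → Term
  lvlT e (var l)   = var (e ∸ suc l)
  lvlT e (par a)   = par a
  lvlT e (fn f ts) = fn f (lvlTs e ts)

  lvlTs : ℕ → List Term → List Term
  lvlTs e []       = []
  lvlTs e (t ∷ ts) = lvlT e t ∷ lvlTs e ts

lookupEnv : List Term → ℕ → Term → Term
lookupEnv []        i       d = d
lookupEnv (u ∷ env) zero    d = u
lookupEnv (u ∷ env) (suc i) d = lookupEnv env i d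

mutual
  trT : List Term → ℕ → Term → Term
  trT env e (var i)   = lvlT e (lookupEnv env i (var i))
  trT env e (par a)   = par a
  trT env e (fn f ts) = fn f (trTs env e ts)

  trTs : List Term → ℕ → List Term → List Term
  trTs env e []       = []
  trTs env e (t ∷ ts) = trT env e t ∷ trTs env e ts

-- pol = true : positive position; false : negative position
sk : Bool → List Term → List ℕ → ℕ → ℕ → Formula → Formula × ℕ
sk p env ws e c (atom P ts) = atom P (trTs env e ts) , c
sk p env ws e c ⊥'          = ⊥' , c
sk p env ws e c (A ∧' B) with sk p env ws e c A
... | A' , c₁ with sk p env ws e c₁ B
... | B' , c₂ = (A' ∧' B') , c₂
sk p env ws e c (A ∨' B) with sk p env ws e c A
... | A' , c₁ with sk p env ws e c₁ B
... | B' , c₂ = (A' ∨' B') , c₂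
sk p env ws e c (A ⇒' B) with sk (not p) env ws e c A
... | A' , c₁ with sk p env ws e c₁ B
... | B' , c₂ = (A' ⇒' B') , c₂
sk true  env ws e c (all' A) = sk true (fn c (map var ws) ∷ env) ws e (suc c) A
sk false env ws e c (all' A) with sk false (var e ∷ env) (ws ++ [ e ]) (suc e) c A
... | A' , c₁ = all' A' , c₁
sk true  env ws e c (ex' A) with sk true (var e ∷ env) (ws ++ [ e ]) (suc e) c A
... | A' , c₁ = ex' A' , c₁
sk false env ws e c (ex' A) = sk false (fn c (map var ws) ∷ env) ws e (suc c) A

skList : Bool → ℕ → List Formula → List Formula × ℕ
skList p c []       = [] , c
skList p c (A ∷ As) with sk p [] [] 0 c A
... | A' , c₁ with skList p c₁ As
... | As' , c₂ = (A' ∷ As') , c₂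

mutual
  funsT : Term → List ℕ
  funsT (var i)   = []
  funsT (par a)   = []
  funsT (fn f ts) = f ∷ funsTs ts

  funsTs : List Term → List ℕ
  funsTs []       = []
  funsTs (t ∷ ts) = funsT t ++ funsTs ts

funsF : Formula → List ℕ
funsF (atom P ts) = funsTs ts
funsF ⊥'          = []
funsF (A ∧' B)    = funsF A ++ funsF B
funsF (A ∨' B)    = funsF A ++ funsF B
funsF (A ⇒' B)    = funsF A ++ funsF B
funsF (all' A)    = funsF A
funsF (ex' A)     = funsF A

funsL : List Formula → List ℕ
funsL []       = []
funsL (A ∷ As) = funsF A ++ funsL As

maxL : List ℕ → ℕ
maxL = foldr _⊔_ 0

-- (Γ ⇒ Δ)^S = Π ⇒ Λ : Skolemize ⋀Γ → ⋁Δ, i.e. the formulas of Γ in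
-- negative and those of Δ in positive position, left to right, Γ first,
-- with Skolem symbols fresh for the sequent.
skolemSeq : List Formula → List Formula → List Formula × List Formula
skolemSeq Γ Δ with skList false (suc (maxL (funsL Γ ++ funsL Δ))) Γ
... | Π , c with skList true c Δ
... | Λ , _ = Π , Λ

module Submission where

-- Every Skolem term f(t₁,…,tₙ) of the given proof of (Γ ⇒ Δ)^S is replaced,
-- innermost first, by the free variable numbered by the code of the strong-quantifier formula
-- Qx.B that f stands for, instantiated as the arguments tᵢ dictate. Weak-quantifier,
-- propositional and structural inferences then carry over unchanged, while the strong
-- quantifiers of Γ ⇒ Δ, which have no counterpart in the Skolemized proof, are introduced by
-- ∀R/∃L with exactly these variables directly below the inference that makes their formula
-- principal. So the characteristic variable of every strong inference is the code of its
-- principal formula: as coding is injective, inferences with the same characteristic variable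
-- have the same principal formula; as the code of a formula exceeds its free variables,
-- a <_π b implies b < a, so <_π is acyclic; and the closed end-sequent contains none of them.
-- Succedents keep their length and no cut is introduced, so the result is cut-free LJ⁺⁺.

open import Defs
open import Data.Bool using (Bool; true; false; not; T; if_then_else_; _∧_)
open import Data.Bool.Properties using (∧-conicalˡ; ∧-conicalʳ)
open import Data.Empty using (⊥; ⊥-elim)
open import Data.List using (List; []; _∷_; _++_; [_]; map; length)
open import Data.List.Properties using (∷-injectiveʳ; ++-identityʳ; ++-conicalˡ; ++-conicalʳ; ++-assoc; map-++)
open import Data.List.Membership.Propositional using (_∈_; _∉_)
open import Data.List.Membership.Propositional.Properties using (∈-++⁻; ∈-++⁺ˡ; ∈-++⁺ʳ)
open import Data.List.Relation.Binary.Permutation.Propositional as ↭ using (_↭_; prep; swap)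
open import Data.List.Relation.Binary.Pointwise using (Pointwise; []; _∷_; Pointwise-length)
open import Data.List.Relation.Unary.All as All using (All; []; _∷_)
open import Data.List.Relation.Unary.All.Properties using (++⁺; ++⁻ˡ; ++⁻ʳ)
open import Data.List.Relation.Unary.Any using (here; there)
open import Data.Nat using (ℕ; zero; suc; _+_; _∸_; _<_; _≤_; _≡ᵇ_; _<ᵇ_; _≤ᵇ_; s≤s; z≤n)
open import Data.Nat.Binary using (ℕᵇ; zero; 2[1+_]; 1+[2_]; toℕ)
open import Data.Nat.Binary.Properties using (toℕ-injective; 1+[2_]-injective; 2[1+_]-injective)
open import Data.Nat.Properties
open import Data.Product using (Σ; Σ-syntax; _×_; _,_; proj₁; proj₂)
open import Data.Sum using (_⊎_; inj₁; inj₂)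
open import Data.Unit using (⊤; tt)
open import Function using (_∘_)
open import Relation.Binary.Construct.Closure.Transitive as Plus using (TransClosure; _∷_)
open import Relation.Binary.Definitions using (tri<; tri≈; tri>)
open import Relation.Binary.PropositionalEquality hiding ([_])
open import Relation.Nullary using (¬_; yes; no; contradiction)

-- Coding formulas by numbers

unary : ℕ → List Bool → List Bool
unary zero    bs = false ∷ bs
unary (suc n) bs = true ∷ unary n bs

unary-injective : ∀ m n {r s} → unary m r ≡ unary n s → m ≡ n × r ≡ s
unary-injective zero    zero    e = refl , ∷-injectiveʳ e
unary-injective (suc m) (suc n) e with refl , r≡s ← unary-injective m n (∷-injectiveʳ e) = refl , r≡s

mutual
  bitsTerm : Term → List Bool → List Bool
  bitsTerm (var i)   bs = false ∷ false ∷ unary i bs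
  bitsTerm (par a)   bs = false ∷ true ∷ unary a bs
  bitsTerm (fn f ts) bs = true ∷ unary f (bitsTerms ts bs)

  bitsTerms : List Term → List Bool → List Bool
  bitsTerms []       bs = false ∷ bs
  bitsTerms (t ∷ ts) bs = true ∷ bitsTerm t (bitsTerms ts bs)

mutual
  bitsTerm-injective : ∀ t u {r s} → bitsTerm t r ≡ bitsTerm u s → t ≡ u × r ≡ s
  bitsTerm-injective (var i) (var j) e
    with refl , r≡s ← unary-injective i j (∷-injectiveʳ (∷-injectiveʳ e)) = refl , r≡s
  bitsTerm-injective (par a) (par b) e
    with refl , r≡s ← unary-injective a b (∷-injectiveʳ (∷-injectiveʳ e)) = refl , r≡s
  bitsTerm-injective (fn f ts) (fn g us) e
    with refl , e′ ← unary-injective f g (∷-injectiveʳ e)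
    with refl , r≡s ← bitsTerms-injective ts us e′ = refl , r≡s
  bitsTerm-injective (var _)  (par _)  ()
  bitsTerm-injective (var _)  (fn _ _) ()
  bitsTerm-injective (par _)  (var _)  ()
  bitsTerm-injective (par _)  (fn _ _) ()
  bitsTerm-injective (fn _ _) (var _)  ()
  bitsTerm-injective (fn _ _) (par _)  ()

  bitsTerms-injective : ∀ ts us {r s} → bitsTerms ts r ≡ bitsTerms us s → ts ≡ us × r ≡ s
  bitsTerms-injective []       []       e = refl , ∷-injectiveʳ e
  bitsTerms-injective (t ∷ ts) (u ∷ us) e
    with refl , e′ ← bitsTerm-injective t u (∷-injectiveʳ e)
    with refl , r≡s ← bitsTerms-injective ts us e′ = refl , r≡s
  bitsTerms-injective []      (_ ∷ _) ()
  bitsTerms-injective (_ ∷ _) []      ()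

n<length-unary : ∀ n bs → n < length (unary n bs)
n<length-unary zero    bs = s≤s z≤n
n<length-unary (suc n) bs = s≤s (n<length-unary n bs)

length<length-unary : ∀ n bs → length bs < length (unary n bs)
length<length-unary zero    bs = n<1+n _
length<length-unary (suc n) bs = m<n⇒m<1+n (length<length-unary n bs)

mutual
  length<length-bitsTerm : ∀ t bs → length bs < length (bitsTerm t bs)
  length<length-bitsTerm (var i)   bs = m<n⇒m<1+n (m<n⇒m<1+n (length<length-unary i bs))
  length<length-bitsTerm (par a)   bs = m<n⇒m<1+n (m<n⇒m<1+n (length<length-unary a bs))
  length<length-bitsTerm (fn f ts) bs = m<n⇒m<1+n (<-trans (length<length-bitsTerms ts bs) (length<length-unary f _))

  length<length-bitsTerms : ∀ ts bs → length bs < length (bitsTerms ts bs)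
  length<length-bitsTerms []       bs = n<1+n _
  length<length-bitsTerms (t ∷ ts) bs = m<n⇒m<1+n (<-trans (length<length-bitsTerms ts bs) (length<length-bitsTerm t _))

mutual
  fvT<length-bitsTerm : ∀ {a} t bs → a ∈ fvT t → a < length (bitsTerm t bs)
  fvT<length-bitsTerm (par a)   bs (here refl) = m<n⇒m<1+n (m<n⇒m<1+n (n<length-unary a bs))
  fvT<length-bitsTerm (fn f ts) bs a∈ts =
    m<n⇒m<1+n (<-trans (fvTs<length-bitsTerms ts bs a∈ts) (length<length-unary f _))

  fvTs<length-bitsTerms : ∀ {a} ts bs → a ∈ fvTs ts → a < length (bitsTerms ts bs)
  fvTs<length-bitsTerms (t ∷ ts) bs a∈ with ∈-++⁻ (fvT t) a∈
  ... | inj₁ a∈t  = m<n⇒m<1+n (fvT<length-bitsTerm t _ a∈t)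
  ... | inj₂ a∈ts = m<n⇒m<1+n (<-trans (fvTs<length-bitsTerms ts bs a∈ts) (length<length-bitsTerm t _))

reifyF : Formula → Term
reifyF (atom P ts) = fn 0 (fn P [] ∷ ts)
reifyF ⊥'          = fn 1 []
reifyF (A ∧' B)    = fn 2 (reifyF A ∷ reifyF B ∷ [])
reifyF (A ∨' B)    = fn 3 (reifyF A ∷ reifyF B ∷ [])
reifyF (A ⇒' B)    = fn 4 (reifyF A ∷ reifyF B ∷ [])
reifyF (all' A)    = fn 5 [ reifyF A ]
reifyF (ex' A)     = fn 6 [ reifyF A ]

reflectF : Term → Formula
reflectF (fn 0 (fn P [] ∷ ts)) = atom P ts
reflectF (fn 2 (a ∷ b ∷ _))    = reflectF a ∧' reflectF b
reflectF (fn 3 (a ∷ b ∷ _))    = reflectF a ∨' reflectF b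
reflectF (fn 4 (a ∷ b ∷ _))    = reflectF a ⇒' reflectF b
reflectF (fn 5 (a ∷ _))        = all' (reflectF a)
reflectF (fn 6 (a ∷ _))        = ex' (reflectF a)
reflectF _                     = ⊥'

reflectF-reifyF : ∀ A → reflectF (reifyF A) ≡ A
reflectF-reifyF (atom P ts) = refl
reflectF-reifyF ⊥'          = refl
reflectF-reifyF (A ∧' B)    = cong₂ _∧'_ (reflectF-reifyF A) (reflectF-reifyF B)
reflectF-reifyF (A ∨' B)    = cong₂ _∨'_ (reflectF-reifyF A) (reflectF-reifyF B)
reflectF-reifyF (A ⇒' B)    = cong₂ _⇒'_ (reflectF-reifyF A) (reflectF-reifyF B)
reflectF-reifyF (all' A)    = cong all' (reflectF-reifyF A)
reflectF-reifyF (ex' A)     = cong ex' (reflectF-reifyF A)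

fvT-reifyF : ∀ A → fvT (reifyF A) ≡ fvF A
fvT-reifyF (atom P ts) = refl
fvT-reifyF ⊥'          = refl
fvT-reifyF (A ∧' B)    = cong₂ _++_ (fvT-reifyF A) (trans (++-identityʳ _) (fvT-reifyF B))
fvT-reifyF (A ∨' B)    = cong₂ _++_ (fvT-reifyF A) (trans (++-identityʳ _) (fvT-reifyF B))
fvT-reifyF (A ⇒' B)    = cong₂ _++_ (fvT-reifyF A) (trans (++-identityʳ _) (fvT-reifyF B))
fvT-reifyF (all' A)    = trans (++-identityʳ _) (fvT-reifyF A)
fvT-reifyF (ex' A)     = trans (++-identityʳ _) (fvT-reifyF A)

fromBits : List Bool → ℕᵇ
fromBits []           = zero
fromBits (false ∷ bs) = 1+[2 fromBits bs ]
fromBits (true ∷ bs)  = 2[1+ fromBits bs ]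

fromBits-injective : ∀ bs cs → fromBits bs ≡ fromBits cs → bs ≡ cs
fromBits-injective []           []           _ = refl
fromBits-injective (false ∷ bs) (false ∷ cs) e = cong (false ∷_) (fromBits-injective bs cs (1+[2_]-injective e))
fromBits-injective (true ∷ bs)  (true ∷ cs)  e = cong (true ∷_) (fromBits-injective bs cs (2[1+_]-injective e))
fromBits-injective []           (false ∷ _)  ()
fromBits-injective []           (true ∷ _)   ()
fromBits-injective (false ∷ _)  []           ()
fromBits-injective (false ∷ _)  (true ∷ _)   ()
fromBits-injective (true ∷ _)   []           ()
fromBits-injective (true ∷ _)   (false ∷ _)  ()

length≤toℕ-fromBits : ∀ bs → length bs ≤ toℕ (fromBits bs)
length≤toℕ-fromBits []           = z≤n
length≤toℕ-fromBits (false ∷ bs) = s≤s (≤-trans (length≤toℕ-fromBits bs) (m≤m+n _ _))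
length≤toℕ-fromBits (true ∷ bs)  = s≤s (≤-trans (length≤toℕ-fromBits bs) (m≤m+n _ _))

code : Formula → ℕ
code A = toℕ (fromBits (bitsTerm (reifyF A) []))

code-injective : ∀ {A B} → code A ≡ code B → A ≡ B
code-injective {A} {B} e = begin
  A                             ≡⟨ sym (reflectF-reifyF A) ⟩
  reflectF (reifyF A)           ≡⟨ cong reflectF (proj₁ (bitsTerm-injective (reifyF A) (reifyF B) bits≡)) ⟩
  reflectF (reifyF B)           ≡⟨ reflectF-reifyF B ⟩
  B                             ∎
  where
  open ≡-Reasoning
  bits≡ = fromBits-injective _ _ (toℕ-injective e)

fvF<code : ∀ {a} A → a ∈ fvF A → a < code A
fvF<code A a∈A = ≤-trans (fvT<length-bitsTerm (reifyF A) [] (subst (_ ∈_) (sym (fvT-reifyF A)) a∈A))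
                         (length≤toℕ-fromBits (bitsTerm (reifyF A) []))

CanonicalEigenvariables : ∀ {Γ Δ} → Γ ⊢ Δ → Set
CanonicalEigenvariables π = ∀ {a F} → (a , F) ∈ strongs π → a ≡ code F

fvL-AllClosed : ∀ {Γ} → AllClosed Γ → fvL Γ ≡ []
fvL-AllClosed []                       = refl
fvL-AllClosed ((_ , fvF≡[]) ∷ closed) rewrite fvF≡[] = fvL-AllClosed closed

canonical-++ : ∀ {Γ Δ Γ′ Δ′} (π : Γ ⊢ Δ) (π′ : Γ′ ⊢ Δ′) →
               CanonicalEigenvariables π → CanonicalEigenvariables π′ →
               ∀ {a F} → (a , F) ∈ strongs π ++ strongs π′ → a ≡ code F
canonical-++ π π′ can can′ aF∈ with ∈-++⁻ (strongs π) aF∈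
... | inj₁ aF∈π  = can aF∈π
... | inj₂ aF∈π′ = can′ aF∈π′

module _ {Γ Δ} (π : Γ ⊢ Δ) (canonical : CanonicalEigenvariables π) where

  <[]⇒> : ∀ {a b} → a <[ π ] b → b < a
  <[]⇒> (F , aF∈π , b∈F) rewrite canonical aF∈π = fvF<code F b∈F

  <[]⁺⇒> : ∀ {a b} → TransClosure (λ x y → x <[ π ] y) a b → b < a
  <[]⁺⇒> Plus.[ a<b ]   = <[]⇒> a<b
  <[]⁺⇒> (a<b ∷ b<⁺c) = <-trans (<[]⁺⇒> b<⁺c) (<[]⇒> a<b)

canonical⇒suitable : ∀ {Γ Δ} → ClosedSequent Γ Δ → (π : Γ ⊢ Δ) → CanonicalEigenvariables π →
                     Suitable π
canonical⇒suitable {Γ} {Δ} (closedΓ , closedΔ) π canonical =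
  eigenvariable-fresh , acyclic , principal-unique
  where
  eigenvariable-fresh : ∀ {a F} → (a , F) ∈ strongs π → a ∉ (fvL Γ ++ fvL Δ)
  eigenvariable-fresh _ rewrite fvL-AllClosed closedΓ | fvL-AllClosed closedΔ = λ ()

  acyclic : Acyclic π
  acyclic a a<⁺a = <-irrefl refl (<[]⁺⇒> π canonical a<⁺a)

  principal-unique : ∀ {a F G} → (a , F) ∈ strongs π → (a , G) ∈ strongs π → F ≡ G
  principal-unique aF∈π aG∈π = code-injective (trans (sym (canonical aF∈π)) (canonical aG∈π))

CanonicalCutFreeLJ : List Formula → List Formula → Set
CanonicalCutFreeLJ Γ Δ = Σ (Γ ⊢ Δ) λ π → CutFree π × LJ π × CanonicalEigenvariables π

canonical⇒CutFreeLJ⁺⁺ : ∀ {Γ Δ} → ClosedSequent Γ Δ → CanonicalCutFreeLJ Γ Δ → CutFreeLJ⁺⁺ Γ Δ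
canonical⇒CutFreeLJ⁺⁺ closed (π , cf , lj , canonical) = π , cf , lj , canonical⇒suitable closed π canonical

-- Undoing Skolemization in a proof

module _ {R : Formula → Formula → Set} where

  data SplitPointwise (xs ys : List Formula) : List Formula → Set where
    split : ∀ {zs ws} → Pointwise R xs zs → Pointwise R ys ws → SplitPointwise xs ys (zs ++ ws)

  splitPointwise : ∀ xs {ys zs} → Pointwise R (xs ++ ys) zs → SplitPointwise xs ys zs
  splitPointwise []       rs       = split [] rs
  splitPointwise (x ∷ xs) (r ∷ rs) with splitPointwise xs rs
  ... | split rs₁ rs₂ = split (r ∷ rs₁) rs₂

  Pointwise-↭ : ∀ {xs ys zs} → xs ↭ ys → Pointwise R ys zs →
                Σ[ ws ∈ List Formula ] Pointwise R xs ws × ws ↭ zs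
  Pointwise-↭ ↭.refl           rs           = _ , rs , ↭.refl
  Pointwise-↭ (prep x p)       (r ∷ rs)     with Pointwise-↭ p rs
  ... | _ , rs′ , q = _ , r ∷ rs′ , prep _ q
  Pointwise-↭ (swap x y p)     (r ∷ s ∷ rs) with Pointwise-↭ p rs
  ... | _ , rs′ , q = _ , s ∷ r ∷ rs′ , swap _ _ q
  Pointwise-↭ (↭.trans p q)    rs           with Pointwise-↭ q rs
  ... | _ , rs′ , q′ with Pointwise-↭ p rs′
  ... | _ , rs″ , p′ = _ , rs″ , ↭.trans p′ q′

NotStrongL : Formula → Set
NotStrongL (ex' _) = ⊥
NotStrongL _       = ⊤

NotStrongR : Formula → Set
NotStrongR (all' _) = ⊥
NotStrongR _        = ⊤

module Unskolemize (σ : Term → Term) (σ-lc : ∀ {t} → LCTerm t → LCTerm (σ t)) where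

  infixr 6 _∧'_
  infixr 5 _∨'_
  infixr 4 _⇒'_

  data Skolemized : Bool → Formula → Formula → Set where
    atom    : ∀ {p} P ts → Skolemized p (atom P ts) (atom P (map σ ts))
    ⊥'      : ∀ {p} → Skolemized p ⊥' ⊥'
    _∧'_    : ∀ {p A′ A B′ B} → Skolemized p A′ A → Skolemized p B′ B →
              Skolemized p (A′ ∧' B′) (A ∧' B)
    _∨'_    : ∀ {p A′ A B′ B} → Skolemized p A′ A → Skolemized p B′ B →
              Skolemized p (A′ ∨' B′) (A ∨' B)
    _⇒'_    : ∀ {p A′ A B′ B} → Skolemized (not p) A′ A → Skolemized p B′ B →
              Skolemized p (A′ ⇒' B′) (A ⇒' B)
    weak∀   : ∀ {A′ A} → (∀ t → LCTerm t → Skolemized false (inst A′ t) (inst A (σ t))) →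
              Skolemized false (all' A′) (all' A)
    weak∃   : ∀ {A′ A} → (∀ t → LCTerm t → Skolemized true (inst A′ t) (inst A (σ t))) →
              Skolemized true (ex' A′) (ex' A)
    strong∀ : ∀ {F′ A} → Skolemized true F′ (inst A (par (code (all' A)))) → Skolemized true F′ (all' A)
    strong∃ : ∀ {F′ A} → Skolemized false F′ (inst A (par (code (ex' A)))) → Skolemized false F′ (ex' A)

  -- The continuation gets F with its leading strong ∃s instantiated, as G; NotStrongL G spares it
  -- the strong∃ case.
  peelStrongL : ∀ {F′ F Γ Δ} → length Δ ≤ 1 → Skolemized false F′ F →
                (∀ {G} → Skolemized false F′ G → NotStrongL G → CanonicalCutFreeLJ (G ∷ Γ) Δ) →
                CanonicalCutFreeLJ (F ∷ Γ) Δ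
  peelStrongL len (strong∃ {A = A} d) k with peelStrongL len d k
  ... | ρ , cf , lj , can = ∃L A (code (ex' A)) ρ , cf , (len , lj) , λ where
    (here refl) → refl
    (there aF∈) → can aF∈
  peelStrongL len d@(atom _ _) k = k d tt
  peelStrongL len d@⊥'         k = k d tt
  peelStrongL len d@(_ ∧' _)   k = k d tt
  peelStrongL len d@(_ ∨' _)   k = k d tt
  peelStrongL len d@(_ ⇒' _)   k = k d tt
  peelStrongL len d@(weak∀ _)  k = k d tt

  peelStrongR : ∀ {F′ F Γ Δ} → length (F ∷ Δ) ≤ 1 → Skolemized true F′ F →
                (∀ {G} → Skolemized true F′ G → NotStrongR G → CanonicalCutFreeLJ Γ (G ∷ Δ)) →
                CanonicalCutFreeLJ Γ (F ∷ Δ)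
  peelStrongR len (strong∀ {A = A} d) k with peelStrongR len d k
  ... | ρ , cf , lj , can = ∀R A (code (all' A)) ρ , cf , (len , lj) , λ where
    (here refl) → refl
    (there aF∈) → can aF∈
  peelStrongR len d@(atom _ _) k = k d tt
  peelStrongR len d@⊥'         k = k d tt
  peelStrongR len d@(_ ∧' _)   k = k d tt
  peelStrongR len d@(_ ∨' _)   k = k d tt
  peelStrongR len d@(_ ⇒' _)   k = k d tt
  peelStrongR len d@(weak∃ _)  k = k d tt

  ¬Skolemized⁺-all : ∀ {A′ F} → Skolemized true (all' A′) F → ⊥
  ¬Skolemized⁺-all (strong∀ d) = ¬Skolemized⁺-all d

  ¬Skolemized⁻-ex : ∀ {A′ F} → Skolemized false (ex' A′) F → ⊥
  ¬Skolemized⁻-ex (strong∃ d) = ¬Skolemized⁻-ex d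

  mutual
    unskolemize : ∀ {Γ′ Δ′ Γ Δ} (π : Γ′ ⊢ Δ′) → CutFree π → LJ π →
                  Pointwise (Skolemized false) Γ′ Γ → Pointwise (Skolemized true) Δ′ Δ →
                  CanonicalCutFreeLJ Γ Δ
    unskolemize π cf (len′ , lj) dΓ dΔ =
      unskolemizeRule π cf lj dΓ dΔ (subst (_≤ 1) (Pointwise-length dΔ) len′)

    unskolemizeRule : ∀ {Γ′ Δ′ Γ Δ} (π : Γ′ ⊢ Δ′) → CutFree π → LJsub π →
                      Pointwise (Skolemized false) Γ′ Γ → Pointwise (Skolemized true) Δ′ Δ →
                      length Δ ≤ 1 → CanonicalCutFreeLJ Γ Δ
    unskolemizeRule (ax P ts) _ _ (dl ∷ []) (dr ∷ []) len =
      peelStrongL len dl λ { (atom _ _) _ →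
      peelStrongR len dr λ { (atom _ _) _ → ax P (map σ ts) , tt , (len , tt) , λ () } }
    unskolemizeRule botL _ _ (dl ∷ []) [] len =
      peelStrongL len dl λ { ⊥' _ → botL , tt , (len , tt) , λ () }
    unskolemizeRule (exch p q π) cf lj dΓ dΔ len with Pointwise-↭ p dΓ | Pointwise-↭ q dΔ
    ... | _ , dΓ′ , p′ | _ , dΔ′ , q′ with unskolemize π cf lj dΓ′ dΔ′
    ... | ρ , cf′ , lj′ , can = exch p′ q′ ρ , cf′ , (len , lj′) , can
    unskolemizeRule (wL A π) cf lj (_ ∷ dΓ) dΔ len with unskolemize π cf lj dΓ dΔ
    ... | ρ , cf′ , lj′ , can = wL _ ρ , cf′ , (len , lj′) , can
    unskolemizeRule (wR A π) cf lj dΓ (_ ∷ dΔ) len with unskolemize π cf lj dΓ dΔ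
    ... | ρ , cf′ , lj′ , can = wR _ ρ , cf′ , (len , lj′) , can
    unskolemizeRule (cL π) cf lj (d ∷ dΓ) dΔ len with unskolemize π cf lj (d ∷ d ∷ dΓ) dΔ
    ... | ρ , cf′ , lj′ , can = cL ρ , cf′ , (len , lj′) , can
    unskolemizeRule (cR π) cf lj dΓ (d ∷ dΔ) len with unskolemize π cf lj dΓ (d ∷ d ∷ dΔ)
    ... | ρ , cf′ , lj′ , can = cR ρ , cf′ , (len , lj′) , can
    unskolemizeRule (∧L₁ B π) cf lj (d ∷ dΓ) dΔ len = peelStrongL len d λ where
      (dA ∧' _) _ → let ρ , cf′ , lj′ , can = unskolemize π cf lj (dA ∷ dΓ) dΔ
                    in ∧L₁ _ ρ , cf′ , (len , lj′) , can
    unskolemizeRule (∧L₂ A π) cf lj (d ∷ dΓ) dΔ len = peelStrongL len d λ where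
      (_ ∧' dB) _ → let ρ , cf′ , lj′ , can = unskolemize π cf lj (dB ∷ dΓ) dΔ
                    in ∧L₂ _ ρ , cf′ , (len , lj′) , can
    unskolemizeRule (∧R π π′) (cf , cf₂) (lj , lj₂) dΓ (d ∷ dΔ) len = peelStrongR len d λ where
      (dA ∧' dB) _ → let ρ  , cf′ , lj′ , can  = unskolemize π  cf  lj  dΓ (dA ∷ dΔ)
                         ρ′ , cf″ , lj″ , can′ = unskolemize π′ cf₂ lj₂ dΓ (dB ∷ dΔ)
                     in ∧R ρ ρ′ , (cf′ , cf″) , (len , (lj′ , lj″)) , canonical-++ ρ ρ′ can can′
    unskolemizeRule (∨L π π′) (cf , cf₂) (lj , lj₂) (d ∷ dΓ) dΔ len = peelStrongL len d λ where
      (dA ∨' dB) _ → let ρ  , cf′ , lj′ , can  = unskolemize π  cf  lj  (dA ∷ dΓ) dΔ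
                         ρ′ , cf″ , lj″ , can′ = unskolemize π′ cf₂ lj₂ (dB ∷ dΓ) dΔ
                     in ∨L ρ ρ′ , (cf′ , cf″) , (len , (lj′ , lj″)) , canonical-++ ρ ρ′ can can′
    unskolemizeRule (∨R₁ B π) cf lj dΓ (d ∷ dΔ) len = peelStrongR len d λ where
      (dA ∨' _) _ → let ρ , cf′ , lj′ , can = unskolemize π cf lj dΓ (dA ∷ dΔ)
                    in ∨R₁ _ ρ , cf′ , (len , lj′) , can
    unskolemizeRule (∨R₂ A π) cf lj dΓ (d ∷ dΔ) len = peelStrongR len d λ where
      (_ ∨' dB) _ → let ρ , cf′ , lj′ , can = unskolemize π cf lj dΓ (dB ∷ dΔ)
                    in ∨R₂ _ ρ , cf′ , (len , lj′) , can
    unskolemizeRule (⇒L {Γ = Γ₁} {Δ = Δ₁} π π′) (cf , cf₂) (lj , lj₂) (d ∷ dΓ) dΔ len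
      with splitPointwise Γ₁ dΓ | splitPointwise Δ₁ dΔ
    ... | split dΓ₁ dΓ₂ | split dΔ₁ dΔ₂ = peelStrongL len d λ where
      (dA ⇒' dB) _ → let ρ  , cf′ , lj′ , can  = unskolemize π  cf  lj  dΓ₁ (dA ∷ dΔ₁)
                         ρ′ , cf″ , lj″ , can′ = unskolemize π′ cf₂ lj₂ (dB ∷ dΓ₂) dΔ₂
                     in ⇒L ρ ρ′ , (cf′ , cf″) , (len , (lj′ , lj″)) , canonical-++ ρ ρ′ can can′
    unskolemizeRule (⇒R π) cf lj dΓ (d ∷ dΔ) len = peelStrongR len d λ where
      (dA ⇒' dB) _ → let ρ , cf′ , lj′ , can = unskolemize π cf lj (dA ∷ dΓ) (dB ∷ dΔ)
                     in ⇒R ρ , cf′ , (len , lj′) , can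
    unskolemizeRule (∀L A t t-lc π) cf lj (d ∷ dΓ) dΔ len = peelStrongL len d λ where
      (weak∀ dA) _ → let ρ , cf′ , lj′ , can = unskolemize π cf lj (dA t t-lc ∷ dΓ) dΔ
                     in ∀L _ (σ t) (σ-lc t-lc) ρ , cf′ , (len , lj′) , can
    unskolemizeRule (∃R A t t-lc π) cf lj dΓ (d ∷ dΔ) len = peelStrongR len d λ where
      (weak∃ dA) _ → let ρ , cf′ , lj′ , can = unskolemize π cf lj dΓ (dA t t-lc ∷ dΔ)
                     in ∃R _ (σ t) (σ-lc t-lc) ρ , cf′ , (len , lj′) , can
    unskolemizeRule (∀R A a π) _ _ _ (d ∷ _) _ = ⊥-elim (¬Skolemized⁺-all d)
    unskolemizeRule (∃L A a π) _ _ (d ∷ _) _ _ = ⊥-elim (¬Skolemized⁻-ex d)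
    unskolemizeRule (cut A π π′) () _ _ _ _

-- Substitution

T⇒≡true : ∀ {b} → T b → b ≡ true
T⇒≡true {true} _ = refl

¬T⇒≡false : ∀ {b} → ¬ T b → b ≡ false
¬T⇒≡false {false} _   = refl
¬T⇒≡false {true}  ¬tt = contradiction tt ¬tt

if-true : ∀ {A : Set} {b} {x y : A} → b ≡ true → (if b then x else y) ≡ x
if-true refl = refl

if-false : ∀ {A : Set} {b} {x y : A} → b ≡ false → (if b then x else y) ≡ y
if-false refl = refl

≡ᵇ-refl : ∀ n → (n ≡ᵇ n) ≡ true
≡ᵇ-refl n = T⇒≡true (≡⇒≡ᵇ n n refl)

≢⇒≡ᵇ-false : ∀ {m n} → m ≢ n → (m ≡ᵇ n) ≡ false
≢⇒≡ᵇ-false {m} {n} m≢n = ¬T⇒≡false (m≢n ∘ ≡ᵇ⇒≡ m n)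

<⇒<ᵇ-true : ∀ {m n} → m < n → (m <ᵇ n) ≡ true
<⇒<ᵇ-true m<n = T⇒≡true (<⇒<ᵇ m<n)

≥⇒<ᵇ-false : ∀ {m n} → n ≤ m → (m <ᵇ n) ≡ false
≥⇒<ᵇ-false {m} {n} n≤m = ¬T⇒≡false (λ m<ᵇn → ≤⇒≯ n≤m (<ᵇ⇒< m n m<ᵇn))

≤⇒≤ᵇ-true : ∀ {m n} → m ≤ n → (m ≤ᵇ n) ≡ true
≤⇒≤ᵇ-true m≤n = T⇒≡true (≤⇒≤ᵇ m≤n)

>⇒≤ᵇ-false : ∀ {m n} → n < m → (m ≤ᵇ n) ≡ false
>⇒≤ᵇ-false {m} {n} n<m = ¬T⇒≡false (λ m≤ᵇn → <⇒≱ n<m (≤ᵇ⇒≤ m n m≤ᵇn))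

allBelow⇒< : ∀ {k is i} → allBelow k is ≡ true → i ∈ is → i < k
allBelow⇒< {k} {i′ ∷ is} below (here refl) = <ᵇ⇒< i′ k (subst T (sym (∧-conicalˡ _ _ below)) tt)
allBelow⇒< {k} {i′ ∷ is} below (there i∈) = allBelow⇒< (∧-conicalʳ (i′ <ᵇ k) _ below) i∈

module _ (f : Term → Term) (fs : List Term → List Term)
         (f-par : ∀ a → f (par a) ≡ par a) (f-fn : ∀ g ts → f (fn g ts) ≡ fn g (fs ts))
         (fs-[] : fs [] ≡ []) (fs-∷ : ∀ t ts → fs (t ∷ ts) ≡ f t ∷ fs ts) where

  mutual
    lc-fixed : ∀ t → LCTerm t → f t ≡ t
    lc-fixed (par a)   _  = f-par a
    lc-fixed (fn g ts) lc = trans (f-fn g ts) (cong (fn g) (lcs-fixed ts lc))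

    lcs-fixed : ∀ ts → bvTs ts ≡ [] → fs ts ≡ ts
    lcs-fixed []       _  = fs-[]
    lcs-fixed (t ∷ ts) lc = trans (fs-∷ t ts)
      (cong₂ _∷_ (lc-fixed t (++-conicalˡ (bvT t) _ lc)) (lcs-fixed ts (++-conicalʳ (bvT t) _ lc)))

lvlT-lc : ∀ e {t} → LCTerm t → lvlT e t ≡ t
lvlT-lc e {t} = lc-fixed (lvlT e) (lvlTs e) (λ _ → refl) (λ _ _ → refl) refl (λ _ _ → refl) t

openT-lc : ∀ k u {t} → LCTerm t → openT k u t ≡ t
openT-lc k u {t} = lc-fixed (openT k u) (openTs k u) (λ _ → refl) (λ _ _ → refl) refl (λ _ _ → refl) t

fn-lc : ∀ f {ts} → All LCTerm ts → LCTerm (fn f ts)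
fn-lc f []                = refl
fn-lc f (lc ∷ lcs) rewrite lc = fn-lc f lcs

lookupEnv-∈ : ∀ env i d → i < length env → lookupEnv env i d ∈ env
lookupEnv-∈ (u ∷ env) zero    d _         = here refl
lookupEnv-∈ (u ∷ env) (suc i) d (s≤s i<n) = there (lookupEnv-∈ env i d i<n)

lookupEnv-map : ∀ (f : Term → Term) env i d d′ → i < length env →
                lookupEnv (map f env) i d ≡ f (lookupEnv env i d′)
lookupEnv-map f (u ∷ env) zero    d d′ _         = refl
lookupEnv-map f (u ∷ env) (suc i) d d′ (s≤s i<n) = lookupEnv-map f env i d d′ i<n

lookupEnv-∈-or-default : ∀ env j d → lookupEnv env j d ∈ env ⊎ lookupEnv env j d ≡ d
lookupEnv-∈-or-default []        j       d = inj₂ refl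
lookupEnv-∈-or-default (u ∷ env) zero    d = inj₁ (here refl)
lookupEnv-∈-or-default (u ∷ env) (suc j) d with lookupEnv-∈-or-default env j d
... | inj₁ u∈env = inj₁ (there u∈env)
... | inj₂ u≡d   = inj₂ u≡d

mutual
  substT : ℕ → List Term → Term → Term
  substT k ρ (var i)   = if i <ᵇ k then var i else lookupEnv ρ (i ∸ k) (var i)
  substT k ρ (par a)   = par a
  substT k ρ (fn f ts) = fn f (substTs k ρ ts)

  substTs : ℕ → List Term → List Term → List Term
  substTs k ρ []       = []
  substTs k ρ (t ∷ ts) = substT k ρ t ∷ substTs k ρ ts

substF : ℕ → List Term → Formula → Formula
substF k ρ (atom P ts) = atom P (substTs k ρ ts)
substF k ρ ⊥'          = ⊥'
substF k ρ (A ∧' B)    = substF k ρ A ∧' substF k ρ B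
substF k ρ (A ∨' B)    = substF k ρ A ∨' substF k ρ B
substF k ρ (A ⇒' B)    = substF k ρ A ⇒' substF k ρ B
substF k ρ (all' A)    = all' (substF (suc k) ρ A)
substF k ρ (ex' A)     = ex' (substF (suc k) ρ A)

∸-suc : ∀ {m n} → n < m → m ∸ n ≡ suc (m ∸ suc n)
∸-suc {m} {n} n<m = +-∸-assoc 1 {m} {suc n} n<m

∸-suc-cancelˡ : ∀ {m n o} → n < m → o < m → m ∸ suc n ≡ m ∸ suc o → n ≡ o
∸-suc-cancelˡ n<m o<m e = suc-injective (∸-cancelˡ-≡ n<m o<m e)

mutual
  openT-substT : ∀ k s {ρ} t → All LCTerm ρ → openT k s (substT (suc k) ρ t) ≡ substT k (s ∷ ρ) t
  openT-substT k s {ρ} (var i) ρ-lc with <-cmp i k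
  ... | tri< i<k _ _
    rewrite <⇒<ᵇ-true (m<n⇒m<1+n i<k) | <⇒<ᵇ-true i<k | ≢⇒≡ᵇ-false (<⇒≢ i<k) = refl
  ... | tri≈ _ refl _
    rewrite <⇒<ᵇ-true (n<1+n i) | ≥⇒<ᵇ-false (≤-refl {i}) | ≡ᵇ-refl i | n∸n≡0 i = refl
  ... | tri> _ _ k<i
    rewrite ≥⇒<ᵇ-false k<i | ≥⇒<ᵇ-false (<⇒≤ k<i) | ∸-suc k<i
    with lookupEnv-∈-or-default ρ (i ∸ suc k) (var i)
  ... | inj₁ u∈ρ = openT-lc k s (All.lookup ρ-lc u∈ρ)
  ... | inj₂ u≡i rewrite u≡i | ≢⇒≡ᵇ-false (>⇒≢ k<i) = refl
  openT-substT k s (par a)   ρ-lc = refl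
  openT-substT k s (fn f ts) ρ-lc = cong (fn f) (openTs-substTs k s ts ρ-lc)

  openTs-substTs : ∀ k s {ρ} ts → All LCTerm ρ → openTs k s (substTs (suc k) ρ ts) ≡ substTs k (s ∷ ρ) ts
  openTs-substTs k s []       ρ-lc = refl
  openTs-substTs k s (t ∷ ts) ρ-lc = cong₂ _∷_ (openT-substT k s t ρ-lc) (openTs-substTs k s ts ρ-lc)

openF-substF : ∀ k s {ρ} A → All LCTerm ρ → openF k s (substF (suc k) ρ A) ≡ substF k (s ∷ ρ) A
openF-substF k s (atom P ts) ρ-lc = cong (atom P) (openTs-substTs k s ts ρ-lc)
openF-substF k s ⊥'          ρ-lc = refl
openF-substF k s (A ∧' B)    ρ-lc = cong₂ _∧'_ (openF-substF k s A ρ-lc) (openF-substF k s B ρ-lc)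
openF-substF k s (A ∨' B)    ρ-lc = cong₂ _∨'_ (openF-substF k s A ρ-lc) (openF-substF k s B ρ-lc)
openF-substF k s (A ⇒' B)    ρ-lc = cong₂ _⇒'_ (openF-substF k s A ρ-lc) (openF-substF k s B ρ-lc)
openF-substF k s (all' A)    ρ-lc = cong all' (openF-substF (suc k) s A ρ-lc)
openF-substF k s (ex' A)     ρ-lc = cong ex' (openF-substF (suc k) s A ρ-lc)

inst-substF : ∀ s {ρ} A → All LCTerm ρ → inst (substF 1 ρ A) s ≡ substF 0 (s ∷ ρ) A
inst-substF s = openF-substF 0 s

mutual
  substT-[] : ∀ k t → substT k [] t ≡ t
  substT-[] k (var i) with i <ᵇ k
  ... | true  = refl
  ... | false = refl
  substT-[] k (par a)   = refl
  substT-[] k (fn f ts) = cong (fn f) (substTs-[] k ts)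

  substTs-[] : ∀ k ts → substTs k [] ts ≡ ts
  substTs-[] k []       = refl
  substTs-[] k (t ∷ ts) = cong₂ _∷_ (substT-[] k t) (substTs-[] k ts)

substF-[] : ∀ k A → substF k [] A ≡ A
substF-[] k (atom P ts) = cong (atom P) (substTs-[] k ts)
substF-[] k ⊥'          = refl
substF-[] k (A ∧' B)    = cong₂ _∧'_ (substF-[] k A) (substF-[] k B)
substF-[] k (A ∨' B)    = cong₂ _∨'_ (substF-[] k A) (substF-[] k B)
substF-[] k (A ⇒' B)    = cong₂ _⇒'_ (substF-[] k A) (substF-[] k B)
substF-[] k (all' A)    = cong all' (substF-[] (suc k) A)
substF-[] k (ex' A)     = cong ex' (substF-[] (suc k) A)

-- Skolemization

strongCount : Bool → Formula → ℕ
strongCount p     (atom _ _) = 0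
strongCount p     ⊥'         = 0
strongCount p     (A ∧' B)   = strongCount p A + strongCount p B
strongCount p     (A ∨' B)   = strongCount p A + strongCount p B
strongCount p     (A ⇒' B)   = strongCount (not p) A + strongCount p B
strongCount true  (all' A)   = suc (strongCount true A)
strongCount false (all' A)   = strongCount false A
strongCount true  (ex' A)    = strongCount true A
strongCount false (ex' A)    = suc (strongCount false A)

-- sk, with the arguments of Skolem terms generalised from levels of binders to terms so that
-- weak quantifiers can be instantiated.
skolemize : Bool → List Term → List Term → ℕ → ℕ → Formula → Formula
skolemize p     env ws e c (atom P ts) = atom P (trTs env e ts)
skolemize p     env ws e c ⊥'          = ⊥'
skolemize p     env ws e c (A ∧' B)    = skolemize p env ws e c A ∧' skolemize p env ws e (c + strongCount p A) B
skolemize p     env ws e c (A ∨' B)    = skolemize p env ws e c A ∨' skolemize p env ws e (c + strongCount p A) B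
skolemize p     env ws e c (A ⇒' B)    =
  skolemize (not p) env ws e c A ⇒' skolemize p env ws e (c + strongCount (not p) A) B
skolemize true  env ws e c (all' A)    = skolemize true (fn c ws ∷ env) ws e (suc c) A
skolemize false env ws e c (all' A)    = all' (skolemize false (var e ∷ env) (ws ++ [ var e ]) (suc e) c A)
skolemize true  env ws e c (ex' A)     = ex' (skolemize true (var e ∷ env) (ws ++ [ var e ]) (suc e) c A)
skolemize false env ws e c (ex' A)     = skolemize false (fn c ws ∷ env) ws e (suc c) A

sk≡skolemize : ∀ p env ws e c A → sk p env ws e c A ≡ (skolemize p env (map var ws) e c A , c + strongCount p A)
sk≡skolemize p env ws e c (atom P ts) = cong₂ _,_ refl (sym (+-identityʳ c))
sk≡skolemize p env ws e c ⊥'          = cong₂ _,_ refl (sym (+-identityʳ c))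
sk≡skolemize p env ws e c (A ∧' B)
  rewrite sk≡skolemize p env ws e c A | sk≡skolemize p env ws e (c + strongCount p A) B =
  cong₂ _,_ refl (+-assoc c _ _)
sk≡skolemize p env ws e c (A ∨' B)
  rewrite sk≡skolemize p env ws e c A | sk≡skolemize p env ws e (c + strongCount p A) B =
  cong₂ _,_ refl (+-assoc c _ _)
sk≡skolemize p env ws e c (A ⇒' B)
  rewrite sk≡skolemize (not p) env ws e c A | sk≡skolemize p env ws e (c + strongCount (not p) A) B =
  cong₂ _,_ refl (+-assoc c _ _)
sk≡skolemize true env ws e c (all' A)
  rewrite sk≡skolemize true (fn c (map var ws) ∷ env) ws e (suc c) A = cong₂ _,_ refl (sym (+-suc c _))
sk≡skolemize false env ws e c (all' A)
  rewrite sk≡skolemize false (var e ∷ env) (ws ++ [ e ]) (suc e) c A | map-++ var ws [ e ] = refl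
sk≡skolemize true env ws e c (ex' A)
  rewrite sk≡skolemize true (var e ∷ env) (ws ++ [ e ]) (suc e) c A | map-++ var ws [ e ] = refl
sk≡skolemize false env ws e c (ex' A)
  rewrite sk≡skolemize false (fn c (map var ws) ∷ env) ws e (suc c) A = cong₂ _,_ refl (sym (+-suc c _))

mutual
  substLevelT : ℕ → Term → Term → Term
  substLevelT L t (var l)   = if l ≡ᵇ L then t else var l
  substLevelT L t (par a)   = par a
  substLevelT L t (fn f ts) = fn f (substLevelTs L t ts)

  substLevelTs : ℕ → Term → List Term → List Term
  substLevelTs L t []       = []
  substLevelTs L t (s ∷ ss) = substLevelT L t s ∷ substLevelTs L t ss

substLevelTs≡map : ∀ L t ss → substLevelTs L t ss ≡ map (substLevelT L t) ss
substLevelTs≡map L t []       = refl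
substLevelTs≡map L t (s ∷ ss) = cong (_ ∷_) (substLevelTs≡map L t ss)

substLevelT-lc : ∀ L t {s} → LCTerm s → substLevelT L t s ≡ s
substLevelT-lc L t {s} =
  lc-fixed (substLevelT L t) (substLevelTs L t) (λ _ → refl) (λ _ _ → refl) refl (λ _ _ → refl) s

substLevelTs-lc : ∀ L t {ss} → All LCTerm ss → substLevelTs L t ss ≡ ss
substLevelTs-lc L t []         = refl
substLevelTs-lc L t (lc ∷ lcs) = cong₂ _∷_ (substLevelT-lc L t lc) (substLevelTs-lc L t lcs)

substLevelT-fresh : ∀ {L d} t → L < d → substLevelT L t (var d) ≡ var d
substLevelT-fresh {L} {d} t L<d rewrite ≢⇒≡ᵇ-false (>⇒≢ L<d) = refl

substLevelTs-snoc : ∀ L t ss s → substLevelTs L t (ss ++ [ s ]) ≡ substLevelTs L t ss ++ [ substLevelT L t s ]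
substLevelTs-snoc L t []        s = refl
substLevelTs-snoc L t (s′ ∷ ss) s = cong (_ ∷_) (substLevelTs-snoc L t ss s)

LevelsWithin : ℕ → ℕ → Term → Set
LevelsWithin L d s = ∀ {l} → l ∈ bvT s → L ≤ l × l < d

lc⇒LevelsWithin : ∀ {L d s} → LCTerm s → LevelsWithin L d s
lc⇒LevelsWithin lc l∈ rewrite lc with l∈
... | ()

var-LevelsWithin : ∀ {L d} → L ≤ d → LevelsWithin L (suc d) (var d)
var-LevelsWithin L≤d (here refl) = L≤d , n<1+n _

LevelsWithin-suc : ∀ {L d s} → LevelsWithin L d s → LevelsWithin L (suc d) s
LevelsWithin-suc within l∈ with within l∈
... | L≤l , l<d = L≤l , m<n⇒m<1+n l<d

fn-LevelsWithin : ∀ {L d} f {ss} → All (LevelsWithin L d) ss → LevelsWithin L d (fn f ss)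
fn-LevelsWithin f (within ∷ withins) l∈ with ∈-++⁻ _ l∈
... | inj₁ l∈s  = within l∈s
... | inj₂ l∈ss = fn-LevelsWithin f withins l∈ss

mutual
  openT-lvlT : ∀ {L d t} s → L < d → LCTerm t → LevelsWithin L d s →
               openT (d ∸ suc L) t (lvlT d s) ≡ lvlT d (substLevelT L t s)
  openT-lvlT {L} {d} {t} (var l) L<d t-lc within with l ≟ L
  ... | yes refl rewrite ≡ᵇ-refl l | ≡ᵇ-refl (d ∸ suc l) = sym (lvlT-lc d t-lc)
  ... | no l≢L
    rewrite ≢⇒≡ᵇ-false l≢L
          | ≢⇒≡ᵇ-false (l≢L ∘ ∸-suc-cancelˡ (proj₂ (within (here refl))) L<d) = refl
  openT-lvlT (par a)   L<d t-lc within = refl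
  openT-lvlT (fn f ts) L<d t-lc within = cong (fn f) (openTs-lvlTs ts L<d t-lc within)

  openTs-lvlTs : ∀ {L d t} ss → L < d → LCTerm t → (∀ {l} → l ∈ bvTs ss → L ≤ l × l < d) →
                 openTs (d ∸ suc L) t (lvlTs d ss) ≡ lvlTs d (substLevelTs L t ss)
  openTs-lvlTs []       L<d t-lc within = refl
  openTs-lvlTs (s ∷ ss) L<d t-lc within =
    cong₂ _∷_ (openT-lvlT s L<d t-lc (within ∘ ∈-++⁺ˡ))
              (openTs-lvlTs ss L<d t-lc (within ∘ ∈-++⁺ʳ (bvT s)))

mutual
  openT-trT : ∀ {L d t env} s → L < d → LCTerm t → All (LevelsWithin L d) env →
              (∀ {i} → i ∈ bvT s → i < length env) →
              openT (d ∸ suc L) t (trT env d s) ≡ trT (substLevelTs L t env) d s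
  openT-trT {L} {d} {t} {env} (var i) L<d t-lc withins bound
    rewrite substLevelTs≡map L t env | lookupEnv-map (substLevelT L t) env i (var i) (var i) (bound (here refl)) =
    openT-lvlT {t = t} (lookupEnv env i (var i)) L<d t-lc
               (All.lookup withins (lookupEnv-∈ env i (var i) (bound (here refl))))
  openT-trT (par a)   L<d t-lc withins bound = refl
  openT-trT (fn f ts) L<d t-lc withins bound = cong (fn f) (openTs-trTs ts L<d t-lc withins bound)

  openTs-trTs : ∀ {L d t env} ss → L < d → LCTerm t → All (LevelsWithin L d) env →
                (∀ {i} → i ∈ bvTs ss → i < length env) →
                openTs (d ∸ suc L) t (trTs env d ss) ≡ trTs (substLevelTs L t env) d ss
  openTs-trTs []       L<d t-lc withins bound = refl
  openTs-trTs (s ∷ ss) L<d t-lc withins bound =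
    cong₂ _∷_ (openT-trT s L<d t-lc withins (bound ∘ ∈-++⁺ˡ))
              (openTs-trTs ss L<d t-lc withins (bound ∘ ∈-++⁺ʳ (bvT s)))

mutual
  openF-skolemize : ∀ {L t} p A env ws d c → L < d → LCTerm t →
                    All (LevelsWithin L d) env → All (LevelsWithin L d) ws → lcF (length env) A ≡ true →
                    openF (d ∸ suc L) t (skolemize p env ws d c A) ≡
                    skolemize p (substLevelTs L t env) (substLevelTs L t ws) d c A
  openF-skolemize p (atom P ts) env ws d c L<d t-lc wenv wws lc =
    cong (atom P) (openTs-trTs ts L<d t-lc wenv (allBelow⇒< lc))
  openF-skolemize p ⊥' env ws d c L<d t-lc wenv wws lc = refl
  openF-skolemize p (A ∧' B) env ws d c L<d t-lc wenv wws lc =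
    cong₂ _∧'_ (openF-skolemize p A env ws d c L<d t-lc wenv wws (∧-conicalˡ _ _ lc))
               (openF-skolemize p B env ws d _ L<d t-lc wenv wws (∧-conicalʳ _ _ lc))
  openF-skolemize p (A ∨' B) env ws d c L<d t-lc wenv wws lc =
    cong₂ _∨'_ (openF-skolemize p A env ws d c L<d t-lc wenv wws (∧-conicalˡ _ _ lc))
               (openF-skolemize p B env ws d _ L<d t-lc wenv wws (∧-conicalʳ _ _ lc))
  openF-skolemize p (A ⇒' B) env ws d c L<d t-lc wenv wws lc =
    cong₂ _⇒'_ (openF-skolemize (not p) A env ws d c L<d t-lc wenv wws (∧-conicalˡ _ _ lc))
               (openF-skolemize p B env ws d _ L<d t-lc wenv wws (∧-conicalʳ _ _ lc))
  openF-skolemize true (all' A) env ws d c L<d t-lc wenv wws lc =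
    openF-skolemize true A (fn c ws ∷ env) ws d (suc c) L<d t-lc (fn-LevelsWithin c wws ∷ wenv) wws lc
  openF-skolemize false (ex' A) env ws d c L<d t-lc wenv wws lc =
    openF-skolemize false A (fn c ws ∷ env) ws d (suc c) L<d t-lc (fn-LevelsWithin c wws ∷ wenv) wws lc
  openF-skolemize false (all' A) env ws d c L<d t-lc wenv wws lc =
    cong all' (openF-skolemize-weak false A env ws d c L<d t-lc wenv wws lc)
  openF-skolemize true (ex' A) env ws d c L<d t-lc wenv wws lc =
    cong ex' (openF-skolemize-weak true A env ws d c L<d t-lc wenv wws lc)

  openF-skolemize-weak : ∀ {L t} p A env ws d c → L < d → LCTerm t →
                         All (LevelsWithin L d) env → All (LevelsWithin L d) ws → lcF (suc (length env)) A ≡ true →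
                         openF (suc (d ∸ suc L)) t (skolemize p (var d ∷ env) (ws ++ [ var d ]) (suc d) c A) ≡
                         skolemize p (var d ∷ substLevelTs L t env) (substLevelTs L t ws ++ [ var d ]) (suc d) c A
  openF-skolemize-weak {L} {t} p A env ws d c L<d t-lc wenv wws lc = begin
    openF (suc (d ∸ suc L)) t X
      ≡⟨ cong (λ k → openF k t X) (sym (∸-suc L<d)) ⟩
    openF (suc d ∸ suc L) t X
      ≡⟨ openF-skolemize p A (var d ∷ env) (ws ++ [ var d ]) (suc d) c (m<n⇒m<1+n L<d) t-lc
           (var-LevelsWithin (<⇒≤ L<d) ∷ All.map (λ {s} → LevelsWithin-suc {s = s}) wenv)
           (++⁺ (All.map (λ {s} → LevelsWithin-suc {s = s}) wws) (var-LevelsWithin (<⇒≤ L<d) ∷ [])) lc ⟩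
    skolemize p (substLevelT L t (var d) ∷ substLevelTs L t env) (substLevelTs L t (ws ++ [ var d ])) (suc d) c A
      ≡⟨ cong₂ (λ x ys → skolemize p (x ∷ substLevelTs L t env) ys (suc d) c A)
               (substLevelT-fresh t L<d)
               (trans (substLevelTs-snoc L t ws (var d))
                      (cong (λ x → substLevelTs L t ws ++ [ x ]) (substLevelT-fresh t L<d))) ⟩
    skolemize p (var d ∷ substLevelTs L t env) (substLevelTs L t ws ++ [ var d ]) (suc d) c A
      ∎
    where
    open ≡-Reasoning
    X = skolemize p (var d ∷ env) (ws ++ [ var d ]) (suc d) c A

substLevelT-hit : ∀ L t → substLevelT L t (var L) ≡ t
substLevelT-hit L t rewrite ≡ᵇ-refl L = refl

inst-skolemize : ∀ p A {envS ws} d c {t} → All LCTerm envS → All LCTerm ws → LCTerm t →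
                 lcF (suc (length envS)) A ≡ true →
                 inst (skolemize p (var d ∷ envS) (ws ++ [ var d ]) (suc d) c A) t ≡
                 skolemize p (t ∷ envS) (ws ++ [ t ]) (suc d) c A
inst-skolemize p A {envS} {ws} d c {t} envS-lc ws-lc t-lc lc = begin
  openF 0 t X
    ≡⟨ cong (λ k → openF k t X) (sym (n∸n≡0 d)) ⟩
  openF (suc d ∸ suc d) t X
    ≡⟨ openF-skolemize p A (var d ∷ envS) (ws ++ [ var d ]) (suc d) c (n<1+n d) t-lc
         (var-LevelsWithin ≤-refl ∷ All.map (λ {s} → lc⇒LevelsWithin {s = s}) envS-lc)
         (++⁺ (All.map (λ {s} → lc⇒LevelsWithin {s = s}) ws-lc) (var-LevelsWithin ≤-refl ∷ [])) lc ⟩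
  skolemize p (substLevelT d t (var d) ∷ substLevelTs d t envS) (substLevelTs d t (ws ++ [ var d ])) (suc d) c A
    ≡⟨ cong₂ (λ env ys → skolemize p env ys (suc d) c A)
             (cong₂ _∷_ (substLevelT-hit d t) (substLevelTs-lc d t envS-lc))
             (trans (substLevelTs-snoc d t ws (var d))
                    (cong₂ (λ ys y → ys ++ [ y ]) (substLevelTs-lc d t ws-lc) (substLevelT-hit d t))) ⟩
  skolemize p (t ∷ envS) (ws ++ [ t ]) (suc d) c A
    ∎
  where
  open ≡-Reasoning
  X = skolemize p (var d ∷ envS) (ws ++ [ var d ]) (suc d) c A

-- The strong-quantifier subformula of A whose Skolem symbol is f (numbered from c as in
-- skolemize), with the bound variables of A instantiated by ρ, the weak quantifiers above it by
-- vs and the strong ones above it by their canonical eigenvariables; ⊥' if there is no such f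
-- or vs is too short.
principal : Bool → ℕ → List Term → List Term → Formula → ℕ → Formula
principal p     c vs       ρ (atom _ _) f = ⊥'
principal p     c vs       ρ ⊥'         f = ⊥'
principal p     c vs       ρ (A ∧' B)   f =
  if f <ᵇ c + strongCount p A then principal p c vs ρ A f else principal p (c + strongCount p A) vs ρ B f
principal p     c vs       ρ (A ∨' B)   f =
  if f <ᵇ c + strongCount p A then principal p c vs ρ A f else principal p (c + strongCount p A) vs ρ B f
principal p     c vs       ρ (A ⇒' B)   f =
  if f <ᵇ c + strongCount (not p) A then principal (not p) c vs ρ A f
  else principal p (c + strongCount (not p) A) vs ρ B f
principal false c []       ρ (all' A)   f = ⊥'
principal false c (v ∷ vs) ρ (all' A)   f = principal false c vs (v ∷ ρ) A f
principal true  c []       ρ (ex' A)    f = ⊥'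
principal true  c (v ∷ vs) ρ (ex' A)    f = principal true c vs (v ∷ ρ) A f
principal true  c vs       ρ (all' A)   f =
  if f ≡ᵇ c then substF 0 ρ (all' A)
  else principal true (suc c) vs (par (code (substF 0 ρ (all' A))) ∷ ρ) A f
principal false c vs       ρ (ex' A)    f =
  if f ≡ᵇ c then substF 0 ρ (ex' A)
  else principal false (suc c) vs (par (code (substF 0 ρ (ex' A))) ∷ ρ) A f

principalIn : ℕ → List (Bool × Formula) → ℕ → List Term → Formula
principalIn c []              f vs = ⊥'
principalIn c ((p , A) ∷ pAs) f vs =
  if f <ᵇ c + strongCount p A then principal p c vs [] A f else principalIn (c + strongCount p A) pAs f vs

module _ {X : Set} (g h : ℕ → X) where

  AgreeFrom : ℕ → Set
  AgreeFrom lo = ∀ {f} → lo ≤ f → g f ≡ h f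

  Agree : ℕ → ℕ → Set
  Agree lo hi = ∀ {f} → lo ≤ f → f < hi → g f ≡ h f

module _ {X : Set} {g h₁ h₂ : ℕ → X} where

  agree-split : ∀ {lo m n} → Agree g (λ f → if f <ᵇ lo + m then h₁ f else h₂ f) lo (lo + (m + n)) →
                Agree g h₁ lo (lo + m) × Agree g h₂ (lo + m) (lo + m + n)
  agree-split {lo} {m} {n} agree =
    (λ lo≤f f<lo+m → trans (agree lo≤f (≤-trans f<lo+m lo+m≤hi)) (if-true (<⇒<ᵇ-true f<lo+m))) ,
    (λ lo+m≤f f<hi → trans (agree (≤-trans (m≤m+n lo m) lo+m≤f) (≤-trans f<hi (≤-reflexive (+-assoc lo m n))))
                           (if-false (≥⇒<ᵇ-false lo+m≤f)))
    where
    lo+m≤hi : lo + m ≤ lo + (m + n)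
    lo+m≤hi = +-monoʳ-≤ lo (m≤m+n m n)

  agreeFrom-split : ∀ {lo m} → lo ≤ m → AgreeFrom g (λ f → if f <ᵇ m then h₁ f else h₂ f) lo →
                    Agree g h₁ lo m × AgreeFrom g h₂ m
  agreeFrom-split lo≤m agree =
    (λ lo≤f f<m → trans (agree lo≤f) (if-true (<⇒<ᵇ-true f<m))) ,
    (λ m≤f → trans (agree (≤-trans lo≤m m≤f)) (if-false (≥⇒<ᵇ-false m≤f)))

module _ {X : Set} {g h : ℕ → X} {x : X} where

  agree-head : ∀ {lo n} → Agree g (λ f → if f ≡ᵇ lo then x else h f) lo (lo + suc n) →
               g lo ≡ x × Agree g h (suc lo) (suc lo + n)
  agree-head {lo} {n} agree =
    trans (agree ≤-refl (≤-trans (s≤s (m≤m+n lo n)) (≤-reflexive (sym (+-suc lo n)))))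
          (if-true (≡ᵇ-refl lo)) ,
    λ lo<f f<hi → trans (agree (<⇒≤ lo<f) (≤-trans f<hi (≤-reflexive (sym (+-suc lo n)))))
                        (if-false (≢⇒≡ᵇ-false (>⇒≢ lo<f)))

-- Deskolemizing the Skolemized sequent

-- The symbols f ≥ c0 are the Skolem symbols, and P f us is the formula witnessed by f(us).
module Deskolemization (c0 : ℕ) (P : ℕ → List Term → Formula) where

  mutual
    deskolemT : Term → Term
    deskolemT (var i)   = var i
    deskolemT (par a)   = par a
    deskolemT (fn f ts) = if c0 ≤ᵇ f then par (code (P f (deskolemTs ts))) else fn f (deskolemTs ts)

    deskolemTs : List Term → List Term
    deskolemTs []       = []
    deskolemTs (t ∷ ts) = deskolemT t ∷ deskolemTs ts

  deskolemTs≡map : ∀ ts → deskolemTs ts ≡ map deskolemT ts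
  deskolemTs≡map []       = refl
  deskolemTs≡map (t ∷ ts) = cong (deskolemT t ∷_) (deskolemTs≡map ts)

  mutual
    deskolemT-lc : ∀ t → LCTerm t → LCTerm (deskolemT t)
    deskolemT-lc (par a)   _  = refl
    deskolemT-lc (fn f ts) lc with c0 ≤ᵇ f
    ... | true  = refl
    ... | false = deskolemTs-lc ts lc

    deskolemTs-lc : ∀ ts → bvTs ts ≡ [] → bvTs (deskolemTs ts) ≡ []
    deskolemTs-lc []       _  = refl
    deskolemTs-lc (t ∷ ts) lc rewrite deskolemT-lc t (++-conicalˡ (bvT t) _ lc) =
      deskolemTs-lc ts (++-conicalʳ (bvT t) _ lc)

  open Unskolemize deskolemT (λ {t} → deskolemT-lc t) public

  map-deskolemT-lc : ∀ {ts} → All LCTerm ts → All LCTerm (map deskolemT ts)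
  map-deskolemT-lc {[]}     []         = []
  map-deskolemT-lc {t ∷ ts} (lc ∷ lcs) = deskolemT-lc t lc ∷ map-deskolemT-lc lcs

  deskolemT-skolemTerm : ∀ {c ws X} → c0 ≤ c → P c (map deskolemT ws) ≡ X →
                         deskolemT (fn c ws) ≡ par (code X)
  deskolemT-skolemTerm {c} {ws} c0≤c P≡X rewrite ≤⇒≤ᵇ-true c0≤c | deskolemTs≡map ws =
    cong (par ∘ code) P≡X

  mutual
    deskolemT-trT : ∀ {env d} s → All LCTerm env → (∀ {i} → i ∈ bvT s → i < length env) →
                    All (_< c0) (funsT s) → deskolemT (trT env d s) ≡ substT 0 (map deskolemT env) s
    deskolemT-trT {env} {d} (var i) env-lc bound _ = begin
      deskolemT (lvlT d u)
        ≡⟨ cong deskolemT (lvlT-lc d {u} (All.lookup env-lc (lookupEnv-∈ env i (var i) i<n))) ⟩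
      deskolemT u
        ≡⟨ lookupEnv-map deskolemT env i (var i) (var i) i<n ⟨
      lookupEnv (map deskolemT env) i (var i) ∎
      where
      open ≡-Reasoning
      i<n = bound (here refl)
      u = lookupEnv env i (var i)
    deskolemT-trT (par a)   _      _     _              = refl
    deskolemT-trT (fn f ts) env-lc bound (f<c0 ∷ funs) rewrite >⇒≤ᵇ-false f<c0 =
      cong (fn f) (deskolemTs-trTs ts env-lc bound funs)

    deskolemTs-trTs : ∀ {env d} ss → All LCTerm env → (∀ {i} → i ∈ bvTs ss → i < length env) →
                      All (_< c0) (funsTs ss) → deskolemTs (trTs env d ss) ≡ substTs 0 (map deskolemT env) ss
    deskolemTs-trTs []       _      _     _    = refl
    deskolemTs-trTs (s ∷ ss) env-lc bound funs =
      cong₂ _∷_ (deskolemT-trT s env-lc (bound ∘ ∈-++⁺ˡ) (++⁻ˡ (funsT s) funs))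
                (deskolemTs-trTs ss env-lc (bound ∘ ∈-++⁺ʳ (bvT s)) (++⁻ʳ (funsT s) funs))

  SourceFormula : ℕ → Formula → Set
  SourceFormula k A = lcF k A ≡ true × All (_< c0) (funsF A)

  SourceFormula-split : ∀ {k A B} → (lcF k A ∧ lcF k B) ≡ true × All (_< c0) (funsF A ++ funsF B) →
                   SourceFormula k A × SourceFormula k B
  SourceFormula-split {A = A} (lc , funs) =
    (∧-conicalˡ _ _ lc , ++⁻ˡ (funsF A) funs) , (∧-conicalʳ _ _ lc , ++⁻ʳ (funsF A) funs)

  PrincipalAgrees : Bool → ℕ → List Term → List Term → Formula → Set
  PrincipalAgrees p c ws env A =
    ∀ vs → Agree (λ f → P f (map deskolemT ws ++ vs)) (principal p c vs (map deskolemT env) A)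
                 c (c + strongCount p A)

  mutual
    skolemize-Skolemized : ∀ p A {env ws} d c → All LCTerm env → All LCTerm ws →
                           SourceFormula (length env) A → c0 ≤ c → PrincipalAgrees p c ws env A →
                           Skolemized p (skolemize p env ws d c A) (substF 0 (map deskolemT env) A)
    skolemize-Skolemized p (atom Q ts) {env} d c env-lc ws-lc (lc , funs) c0≤c agrees =
      subst (Skolemized p (atom Q (trTs env d ts)) ∘ atom Q)
            (trans (sym (deskolemTs≡map _)) (deskolemTs-trTs ts env-lc (allBelow⇒< lc) funs))
            (atom Q (trTs env d ts))
    skolemize-Skolemized p ⊥' d c env-lc ws-lc src c0≤c agrees = ⊥'
    skolemize-Skolemized p (A ∧' B) d c env-lc ws-lc src c0≤c agrees =
      let srcA , srcB = SourceFormula-split {A = A} {B} src in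
      skolemize-Skolemized p A d c env-lc ws-lc srcA c0≤c (λ vs → proj₁ (agree-split (agrees vs))) ∧'
      skolemize-Skolemized p B d _ env-lc ws-lc srcB (≤-trans c0≤c (m≤m+n _ _))
                           (λ vs → proj₂ (agree-split (agrees vs)))
    skolemize-Skolemized p (A ∨' B) d c env-lc ws-lc src c0≤c agrees =
      let srcA , srcB = SourceFormula-split {A = A} {B} src in
      skolemize-Skolemized p A d c env-lc ws-lc srcA c0≤c (λ vs → proj₁ (agree-split (agrees vs))) ∨'
      skolemize-Skolemized p B d _ env-lc ws-lc srcB (≤-trans c0≤c (m≤m+n _ _))
                           (λ vs → proj₂ (agree-split (agrees vs)))
    skolemize-Skolemized p (A ⇒' B) d c env-lc ws-lc src c0≤c agrees =
      let srcA , srcB = SourceFormula-split {A = A} {B} src in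
      skolemize-Skolemized (not p) A d c env-lc ws-lc srcA c0≤c (λ vs → proj₁ (agree-split (agrees vs))) ⇒'
      skolemize-Skolemized p B d _ env-lc ws-lc srcB (≤-trans c0≤c (m≤m+n _ _))
                           (λ vs → proj₂ (agree-split (agrees vs)))
    skolemize-Skolemized false (all' A) d c env-lc ws-lc src c0≤c agrees =
      weak∀ (skolemize-Skolemized-weak false A d c env-lc ws-lc src c0≤c (λ v vs → agrees (v ∷ vs)))
    skolemize-Skolemized true (ex' A) d c env-lc ws-lc src c0≤c agrees =
      weak∃ (skolemize-Skolemized-weak true A d c env-lc ws-lc src c0≤c (λ v vs → agrees (v ∷ vs)))
    skolemize-Skolemized true (all' A) d c env-lc ws-lc src c0≤c agrees =
      strong∀ (skolemize-Skolemized-strong true A d c env-lc ws-lc src c0≤c agrees)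
    skolemize-Skolemized false (ex' A) d c env-lc ws-lc src c0≤c agrees =
      strong∃ (skolemize-Skolemized-strong false A d c env-lc ws-lc src c0≤c agrees)

    skolemize-Skolemized-weak :
      ∀ p A {env ws} d c → All LCTerm env → All LCTerm ws → SourceFormula (suc (length env)) A → c0 ≤ c →
      (∀ v vs → Agree (λ f → P f (map deskolemT ws ++ v ∷ vs)) (principal p c vs (v ∷ map deskolemT env) A)
                      c (c + strongCount p A)) →
      ∀ t → LCTerm t →
      Skolemized p (inst (skolemize p (var d ∷ env) (ws ++ [ var d ]) (suc d) c A) t)
                   (inst (substF 1 (map deskolemT env) A) (deskolemT t))
    skolemize-Skolemized-weak p A {env} {ws} d c env-lc ws-lc src c0≤c agrees t t-lc =
      subst₂ (Skolemized p) (sym (inst-skolemize p A d c env-lc ws-lc t-lc (proj₁ src)))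
                            (sym (inst-substF (deskolemT t) A (map-deskolemT-lc env-lc)))
             (skolemize-Skolemized p A (suc d) c (t-lc ∷ env-lc) (++⁺ ws-lc (t-lc ∷ [])) src c0≤c agrees′)
      where
      agrees′ : PrincipalAgrees p c (ws ++ [ t ]) (t ∷ env) A
      agrees′ vs rewrite map-++ deskolemT ws [ t ] | ++-assoc (map deskolemT ws) [ deskolemT t ] vs =
        agrees (deskolemT t) vs

    skolemize-Skolemized-strong :
      ∀ p A {env ws} d c {X} → All LCTerm env → All LCTerm ws → SourceFormula (suc (length env)) A → c0 ≤ c →
      (∀ vs → Agree (λ f → P f (map deskolemT ws ++ vs))
                    (λ f → if f ≡ᵇ c then X else principal p (suc c) vs (par (code X) ∷ map deskolemT env) A f)
                    c (c + suc (strongCount p A))) →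
      Skolemized p (skolemize p (fn c ws ∷ env) ws d (suc c) A) (inst (substF 1 (map deskolemT env) A) (par (code X)))
    skolemize-Skolemized-strong p A {env} {ws} d c {X} env-lc ws-lc src c0≤c agrees =
      subst (Skolemized p (skolemize p (fn c ws ∷ env) ws d (suc c) A))
            (trans (cong (λ u → substF 0 (u ∷ map deskolemT env) A) deskolem≡)
                   (sym (inst-substF _ A (map-deskolemT-lc env-lc))))
            (skolemize-Skolemized p A d (suc c) (fn-lc c ws-lc ∷ env-lc) ws-lc src (≤-trans c0≤c (n≤1+n c))
                                  agrees′)
      where
      deskolem≡ : deskolemT (fn c ws) ≡ par (code X)
      deskolem≡ =
        deskolemT-skolemTerm c0≤c (trans (cong (P c) (sym (++-identityʳ _))) (proj₁ (agree-head (agrees []))))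
      agrees′ : PrincipalAgrees p (suc c) ws (fn c ws ∷ env) A
      agrees′ vs rewrite deskolem≡ = proj₂ (agree-head (agrees vs))

  PrincipalInAgrees : ℕ → List (Bool × Formula) → Set
  PrincipalInAgrees c pAs = ∀ vs → AgreeFrom (λ f → P f vs) (λ f → principalIn c pAs f vs) c

  skList-Skolemized : ∀ p c As pAs → AllClosed As → All (_< c0) (funsL As) → c0 ≤ c →
                      PrincipalInAgrees c (map (p ,_) As ++ pAs) →
                      Pointwise (Skolemized p) (proj₁ (skList p c As)) As ×
                      PrincipalInAgrees (proj₂ (skList p c As)) pAs
  skList-Skolemized p c []       pAs _                  _    _    agrees = [] , agrees
  skList-Skolemized p c (A ∷ As) pAs ((lc , _) ∷ closed) funs c0≤c agrees
    rewrite sk≡skolemize p [] [] 0 c A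
    with skList-Skolemized p (c + strongCount p A) As pAs closed (++⁻ʳ (funsF A) funs) (≤-trans c0≤c (m≤m+n _ _))
           (λ vs → proj₂ (agreeFrom-split (m≤m+n _ _) (agrees vs)))
  ... | dAs , agrees′ =
    subst (Skolemized p (skolemize p [] [] 0 c A)) (substF-[] 0 A)
          (skolemize-Skolemized p A 0 c [] [] (lc , ++⁻ˡ (funsF A) funs) c0≤c
                                (λ vs → proj₁ (agreeFrom-split (m≤m+n _ _) (agrees vs))))
    ∷ dAs , agrees′

skList-counter-≥ : ∀ p c As → c ≤ proj₂ (skList p c As)
skList-counter-≥ p c []       = ≤-refl
skList-counter-≥ p c (A ∷ As) rewrite sk≡skolemize p [] [] 0 c A =
  ≤-trans (m≤m+n c (strongCount p A)) (skList-counter-≥ p (c + strongCount p A) As)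

<suc-maxL : ∀ xs → All (_< suc (maxL xs)) xs
<suc-maxL []       = []
<suc-maxL (x ∷ xs) = s≤s (m≤m⊔n x _) ∷ All.map (λ y< → ≤-trans y< (s≤s (m≤n⊔m x _))) (<suc-maxL xs)

module DeskolemizeSequent (Γ Δ : List Formula) where

  c0 : ℕ
  c0 = suc (maxL (funsL Γ ++ funsL Δ))

  open Deskolemization c0 (principalIn c0 (map (false ,_) Γ ++ map (true ,_) Δ)) public

  skolemSeq-Skolemized : ClosedSequent Γ Δ →
                         Pointwise (Skolemized false) (proj₁ (skolemSeq Γ Δ)) Γ ×
                         Pointwise (Skolemized true) (proj₂ (skolemSeq Γ Δ)) Δ
  skolemSeq-Skolemized (closedΓ , closedΔ) = proj₁ Γ-skolemized , proj₁ Δ-skolemized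
    where
    funs = <suc-maxL (funsL Γ ++ funsL Δ)
    Γ-skolemized = skList-Skolemized false c0 Γ (map (true ,_) Δ) closedΓ (++⁻ˡ (funsL Γ) funs) ≤-refl
                     (λ _ _ → refl)
    Δ-skolemized = skList-Skolemized true (proj₂ (skList false c0 Γ)) Δ [] closedΔ (++⁻ʳ (funsL Γ) funs)
                     (skList-counter-≥ false c0 Γ)
                     (subst (PrincipalInAgrees _) (sym (++-identityʳ (map (true ,_) Δ))) (proj₂ Γ-skolemized))

mainTheorem7 : (Γ Δ : List Formula) → ClosedSequent Γ Δ →
    CutFreeLJ⁺⁺ (proj₁ (skolemSeq Γ Δ)) (proj₂ (skolemSeq Γ Δ)) →
    CutFreeLJ⁺⁺ Γ Δ
mainTheorem7 Γ Δ closed (π , cf , lj , _) =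
  canonical⇒CutFreeLJ⁺⁺ closed (unskolemize π cf lj (proj₁ skolemized) (proj₂ skolemized))
  where
  open DeskolemizeSequent Γ Δ
  skolemized = skolemSeq-Skolemized closed
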